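{- Let $y$ be an integer with $M(0,y)\ne\emptyset$. Then every minimal graph in $M(0,y)$ is nonseparable.
   Context: All graphs are finite, simple and undirected (the graph with empty vertex set is allowed). $\chi(G)$ is the chromatic number, $\omega(G)$ the clique number, and $f(G)=\chi(G)-\omega(G)$. For integers $x,y$, $M(x,y)$ is the set of graphs $G$ with $|V(G)|<\chi(G)+2f(G)-x$ and $f(G)\le y$. A minimal graph in a nonempty set $\mathcal M$ of graphs is a $G_0\in\mathcal M$ with $|V(G_0)|=\min\{|V(G)|:G\in\mathcal M\}$. For vertex-disjoint graphs $G_1,G_2$, $G_1+G_2$ is their join (the union together with all edges between $V(G_1)$ and $V(G_2)$). A graph $G$ is separable if $G=G_1+G_2$ with $V(G_1)\ne\emptyset$ and $V(G_2)\ne\emptyset$; otherwise it is nonseparable. -}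

module Defs where

open import Data.Nat using (ℕ; _≤_)
open import Data.Integer as ℤ using (ℤ; +_)
open import Data.Fin using (Fin)
open import Data.Bool using (Bool; true; false)
open import Data.Product using (Σ; ∃; _×_; ∃-syntax)
open import Relation.Binary.PropositionalEquality using (_≡_; _≢_)
open import Relation.Nullary using (¬_)
open import Function.Definitions using (Injective)

record Graph : Set where
  field
    n     : ℕ
    adj   : Fin n → Fin n → Bool
    sym   : ∀ u v → adj u v ≡ adj v u
    irrefl : ∀ v → adj v v ≡ false
open Graph public

order : Graph → ℕ
order G = n G

Colourable : Graph → ℕ → Set
Colourable G k = Σ (Fin (n G) → Fin k) λ c →
  ∀ u v → adj G u v ≡ true → c u ≢ c v

HasClique : Graph → ℕ → Set
HasClique G k = Σ (Fin k → Fin (n G)) λ f →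
  Injective _≡_ _≡_ f × (∀ i j → i ≢ j → adj G (f i) (f j) ≡ true)

IsChromaticNumber : Graph → ℕ → Set
IsChromaticNumber G k = Colourable G k × (∀ j → Colourable G j → k ≤ j)

IsCliqueNumber : Graph → ℕ → Set
IsCliqueNumber G k = HasClique G k × (∀ j → HasClique G j → j ≤ k)

-- G ∈ M(x,y):  |V(G)| < χ(G) + 2 f(G) − x  and  f(G) ≤ y, with f = χ − ω
InM : ℤ → ℤ → Graph → Set
InM x y G = ∃[ χ ] ∃[ ω ] (IsChromaticNumber G χ × IsCliqueNumber G ω ×
  ((+ order G) ℤ.< ((+ χ) ℤ.+ (+ 2) ℤ.* ((+ χ) ℤ.- (+ ω))) ℤ.- x) ×
  (((+ χ) ℤ.- (+ ω)) ℤ.≤ y))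

IsMinimalInM : ℤ → ℤ → Graph → Set
IsMinimalInM x y G₀ = InM x y G₀ × (∀ G → InM x y G → order G₀ ≤ order G)

-- G is separable: G = G₁ + G₂ with both parts nonempty, i.e. V(G) splits
-- into two nonempty parts (side true / side false) with every vertex of one
-- part adjacent to every vertex of the other (G₁, G₂ being the induced subgraphs).
Separable : Graph → Set
Separable G = Σ (Fin (n G) → Bool) λ side →
  (∃[ u ] side u ≡ true) × (∃[ v ] side v ≡ false) ×
  (∀ u v → side u ≡ true → side v ≡ false → adj G u v ≡ true)

Nonseparable : Graph → Set
Nonseparable G = ¬ Separable G

-- If G = G₁ + G₂ then χ(G) = χ(G₁) + χ(G₂) and ω(G) = ω(G₁) + ω(G₂), so f(G) = f(G₁) + f(G₂).
-- Hence f(Gᵢ) ≤ f(G) ≤ y for both parts, and |V(G₁)| + |V(G₂)| < (χ(G₁) + 2f(G₁)) + (χ(G₂) + 2f(G₂))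
-- forces |V(Gᵢ)| < χ(Gᵢ) + 2f(Gᵢ) for some i.  That Gᵢ lies in M(0,y) and has fewer vertices
-- than G, so a minimal graph of M(0,y) cannot be a join of two nonempty graphs.
module Submission where

open import Defs hiding (sym)
open import Data.Bool using (Bool; true; false; not)
open import Data.Bool.Properties using (not-injective)
open import Data.Fin using (Fin; zero; suc; splitAt; join)
open import Data.Fin.Properties using (nonZeroIndex; any?; injective⇒≤; splitAt-join; join-splitAt)
  renaming (_≟_ to _≟ᶠ_)
open import Data.Integer as ℤ using (ℤ; +_; +≤+)
import Data.Integer.Properties as ℤₚ
open import Data.Integer.Solver using (module +-*-Solver)
open import Data.Nat as ℕ using (ℕ; zero; suc; _+_; _≤_; _<_; _∸_; >-nonZero⁻¹)
open import Data.Nat.Induction using (<-rec)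
open import Data.Nat.Properties as ℕ
  using (≮⇒≥; ≤-antisym; ∸-monoʳ-<; m<m+n; m<n+m; +-comm; <⇒≱)
open import Data.Product using (∃; ∃₂; ∃-syntax; _×_; _,_; proj₁; proj₂)
open import Data.Sum using (_⊎_; inj₁; inj₂; swap; map; map₁)
open import Data.Sum.Properties using (swap-involutive; inj₁-injective; inj₂-injective)
open import Effect.Monad using (RawMonad)
open import Function using (id; _∘_)
open import Function.Definitions using (Injective)
open import Relation.Binary.PropositionalEquality using (_≡_; _≢_; refl; sym; trans; cong; subst; subst₂)
open import Relation.Nullary using (¬_; yes; no; does)
open import Relation.Nullary.Decidable using (dec-true; dec-false)
open import Relation.Nullary.Negation using (¬¬-Monad)

splitAt-injective : ∀ m {n} → Injective _≡_ _≡_ (splitAt m {n})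
splitAt-injective m {n} {i} {j} eq =
  trans (sym (join-splitAt m n i)) (trans (cong (join m n) eq) (join-splitAt m n j))

join-injective : ∀ m n → Injective _≡_ _≡_ (join m n)
join-injective m n {x} {y} eq =
  trans (sym (splitAt-join m n x)) (trans (cong (splitAt m) eq) (splitAt-join m n y))

map-injective : {A B C D : Set} {f : A → C} {g : B → D} →
  Injective _≡_ _≡_ f → Injective _≡_ _≡_ g → Injective _≡_ _≡_ (map f g)
map-injective f-inj g-inj {inj₁ _} {inj₁ _} eq = cong inj₁ (f-inj (inj₁-injective eq))
map-injective f-inj g-inj {inj₂ _} {inj₂ _} eq = cong inj₂ (g-inj (inj₂-injective eq))

Least : (ℕ → Set) → Set
Least P = ∃ λ k → P k × (∀ j → P j → k ≤ j)

Greatest : (ℕ → Set) → Set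
Greatest P = ∃ λ k → P k × (∀ j → P j → j ≤ k)

-- Without deciding P only the double negation is available; it suffices since Nonseparable is a negation.
¬¬-least : (P : ℕ → Set) {N : ℕ} → P N → ¬ ¬ Least P
¬¬-least P {N} pN ¬least = <-rec (λ k → ¬ P k) below-none N pN
  where
  below-none : ∀ k → (∀ {j} → j < k → ¬ P j) → ¬ P k
  below-none k none pk = ¬least (k , pk , λ j pj → ≮⇒≥ λ j<k → none j<k pj)

¬¬-greatest : (P : ℕ → Set) (B : ℕ) → (∀ j → P j → j ≤ B) → {N : ℕ} → P N → ¬ ¬ Greatest P
¬¬-greatest P B bounded {N} pN ¬greatest = <-rec (λ d → ∀ k → B ∸ k ≡ d → ¬ P k) above-none _ N refl pN
  where
  above-none : ∀ d → (∀ {e} → e < d → ∀ k → B ∸ k ≡ e → ¬ P k) → ∀ k → B ∸ k ≡ d → ¬ P k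
  above-none d none k refl pk = ¬greatest (k , pk , λ j pj → ≮⇒≥ λ k<j →
    none (∸-monoʳ-< k<j (bounded j pj)) j refl pj)

record Partition {m : ℕ} (p : Fin m → Bool) : Set where
  field
    m₁ m₂       : ℕ
    m₁+m₂≡m     : m₁ + m₂ ≡ m
    embed       : Fin m₁ ⊎ Fin m₂ → Fin m
    index       : Fin m → Fin m₁ ⊎ Fin m₂
    embed∘index : ∀ u → embed (index u) ≡ u
    index∘embed : ∀ x → index (embed x) ≡ x
    p-embed₁    : ∀ i → p (embed (inj₁ i)) ≡ true
    p-embed₂    : ∀ j → p (embed (inj₂ j)) ≡ false

  embed-injective : Injective _≡_ _≡_ embed
  embed-injective {x} {y} eq = trans (sym (index∘embed x)) (trans (cong index eq) (index∘embed y))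

  private
    embed-index : ∀ {u x} → index u ≡ x → embed x ≡ u
    embed-index {u} eq = trans (cong embed (sym eq)) (embed∘index u)

  embed₁-surjective : ∀ {u} → p u ≡ true → ∃ λ i → embed (inj₁ i) ≡ u
  embed₁-surjective {u} pu with index u in eq
  ... | inj₁ i = i , embed-index eq
  ... | inj₂ j with () ← trans (sym pu) (trans (cong p (sym (embed-index eq))) (p-embed₂ j))

  embed₂-surjective : ∀ {u} → p u ≡ false → ∃ λ j → embed (inj₂ j) ≡ u
  embed₂-surjective {u} pu with index u in eq
  ... | inj₂ j = j , embed-index eq
  ... | inj₁ i with () ← trans (sym pu) (trans (cong p (sym (embed-index eq))) (p-embed₁ i))

  m₁<m : ∀ {u} → p u ≡ false → m₁ < m
  m₁<m pu = subst (m₁ <_) m₁+m₂≡m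
    (m<m+n m₁ (>-nonZero⁻¹ m₂ {{nonZeroIndex (proj₁ (embed₂-surjective pu))}}))

  m₂<m : ∀ {u} → p u ≡ true → m₂ < m
  m₂<m pu = subst (m₂ <_) m₁+m₂≡m
    (m<n+m m₂ (>-nonZero⁻¹ m₁ {{nonZeroIndex (proj₁ (embed₁-surjective pu))}}))

partition-empty : (p : Fin zero → Bool) → Partition p
partition-empty p = record
  { m₁ = 0 ; m₂ = 0 ; m₁+m₂≡m = refl
  ; embed = λ { (inj₁ ()) ; (inj₂ ()) } ; index = λ ()
  ; embed∘index = λ () ; index∘embed = λ { (inj₁ ()) ; (inj₂ ()) }
  ; p-embed₁ = λ () ; p-embed₂ = λ () }

partition-cons : ∀ {m} {p : Fin (suc m) → Bool} → p zero ≡ true → Partition (p ∘ suc) → Partition p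
partition-cons {m} {p} p0 P = record
  { m₁ = suc m₁ ; m₂ = m₂ ; m₁+m₂≡m = cong suc m₁+m₂≡m
  ; embed = embed′ ; index = index′
  ; embed∘index = embed′∘index′ ; index∘embed = index′∘embed′
  ; p-embed₁ = p-embed′₁ ; p-embed₂ = p-embed₂ }
  where
  open Partition P

  embed′ : Fin (suc m₁) ⊎ Fin m₂ → Fin (suc m)
  embed′ (inj₁ zero)    = zero
  embed′ (inj₁ (suc i)) = suc (embed (inj₁ i))
  embed′ (inj₂ j)       = suc (embed (inj₂ j))

  index′ : Fin (suc m) → Fin (suc m₁) ⊎ Fin m₂
  index′ zero    = inj₁ zero
  index′ (suc u) = map₁ suc (index u)

  embed′∘map₁-suc : ∀ x → embed′ (map₁ suc x) ≡ suc (embed x)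
  embed′∘map₁-suc (inj₁ i) = refl
  embed′∘map₁-suc (inj₂ j) = refl

  embed′∘index′ : ∀ u → embed′ (index′ u) ≡ u
  embed′∘index′ zero    = refl
  embed′∘index′ (suc u) = trans (embed′∘map₁-suc (index u)) (cong suc (embed∘index u))

  index′∘embed′ : ∀ x → index′ (embed′ x) ≡ x
  index′∘embed′ (inj₁ zero)    = refl
  index′∘embed′ (inj₁ (suc i)) = cong (map₁ suc) (index∘embed (inj₁ i))
  index′∘embed′ (inj₂ j)       = cong (map₁ suc) (index∘embed (inj₂ j))

  p-embed′₁ : ∀ i → p (embed′ (inj₁ i)) ≡ true
  p-embed′₁ zero    = p0
  p-embed′₁ (suc i) = p-embed₁ i

partition-not : ∀ {m} {p : Fin m → Bool} → Partition (not ∘ p) → Partition p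
partition-not P = record
  { m₁ = m₂ ; m₂ = m₁ ; m₁+m₂≡m = trans (+-comm m₂ m₁) m₁+m₂≡m
  ; embed = embed ∘ swap ; index = swap ∘ index
  ; embed∘index = λ u → trans (cong embed (swap-involutive (index u))) (embed∘index u)
  ; index∘embed = λ x → trans (cong swap (index∘embed (swap x))) (swap-involutive x)
  ; p-embed₁ = λ i → not-injective (p-embed₂ i)
  ; p-embed₂ = λ j → not-injective (p-embed₁ j) }
  where open Partition P

partition : ∀ {m} (p : Fin m → Bool) → Partition p
partition {zero}  p = partition-empty p
partition {suc m} p with p zero in p0
... | true  = partition-cons p0 (partition (p ∘ suc))
... | false = partition-not (partition-cons (cong not p0) (partition (not ∘ p ∘ suc)))

ProperColouring : (G : Graph) {k : ℕ} → (Fin (n G) → Fin k) → Set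
ProperColouring G c = ∀ u v → adj G u v ≡ true → c u ≢ c v

IsClique : (G : Graph) {k : ℕ} → (Fin k → Fin (n G)) → Set
IsClique G f = Injective _≡_ _≡_ f × (∀ i j → i ≢ j → adj G (f i) (f j) ≡ true)

induced : (G : Graph) {m : ℕ} → (Fin m → Fin (n G)) → Graph
induced G {m} e = record
  { n = m ; adj = λ i j → adj G (e i) (e j)
  ; sym = λ i j → Graph.sym G (e i) (e j) ; irrefl = irrefl G ∘ e }

adjacent⇒≢ : ∀ G {u v} → adj G u v ≡ true → u ≢ v
adjacent⇒≢ G {u} uv refl with () ← trans (sym uv) (irrefl G u)

colourable-order : ∀ G → Colourable G (order G)
colourable-order G = id , λ u v → adjacent⇒≢ G

hasClique-zero : ∀ G → HasClique G 0
hasClique-zero G = (λ ()) , (λ { {()} }) , λ ()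

hasClique⇒≤order : ∀ G {k} → HasClique G k → k ≤ order G
hasClique⇒≤order G (f , f-injective , _) = injective⇒≤ f-injective

hasClique⇒colourable⇒≤ : ∀ G {w k} → HasClique G w → Colourable G k → w ≤ k
hasClique⇒colourable⇒≤ G (f , _ , f-adj) (c , c-proper) = injective⇒≤ {f = c ∘ f} c∘f-injective
  where
  c∘f-injective : Injective _≡_ _≡_ (c ∘ f)
  c∘f-injective {i} {j} eq with i ≟ᶠ j
  ... | yes i≡j = i≡j
  ... | no  i≢j with () ← c-proper (f i) (f j) (f-adj i j i≢j) eq

colourable-induced : ∀ G {m k} (e : Fin m → Fin (n G)) → Colourable G k → Colourable (induced G e) k
colourable-induced G e (c , c-proper) = c ∘ e , λ i j → c-proper (e i) (e j)

colourable-factor : ∀ G {k k′} {c : Fin (n G) → Fin k} → ProperColouring G c →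
  (d : Fin k′ → Fin k) (c′ : Fin (n G) → Fin k′) → (∀ u → d (c′ u) ≡ c u) → Colourable G k′
colourable-factor G c-proper d c′ d∘c′≗c = c′ , λ u v uv eq →
  c-proper u v uv (trans (sym (d∘c′≗c u)) (trans (cong d eq) (d∘c′≗c v)))

hasClique-∘ : ∀ G {k k′} {f : Fin k → Fin (n G)} → IsClique G f →
  (h : Fin k′ → Fin k) → Injective _≡_ _≡_ h → HasClique G k′
hasClique-∘ G (f-injective , f-adj) h h-injective =
  _ , h-injective ∘ f-injective , λ i j i≢j → f-adj (h i) (h j) (i≢j ∘ h-injective)

hasClique-induced : ∀ G {m k} (e : Fin m → Fin (n G)) {f : Fin k → Fin (n G)} → IsClique G f →
  (f′ : Fin k → Fin m) → (∀ i → e (f′ i) ≡ f i) → HasClique (induced G e) k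
hasClique-induced G e (f-injective , f-adj) f′ e∘f′≗f =
  f′ , (λ {i} {j} eq → f-injective (trans (sym (e∘f′≗f i)) (trans (cong e eq) (e∘f′≗f j)))) ,
  λ i j i≢j → subst₂ (λ u v → adj G u v ≡ true) (sym (e∘f′≗f i)) (sym (e∘f′≗f j)) (f-adj i j i≢j)

chromaticNumber-unique : ∀ G {a b} → IsChromaticNumber G a → IsChromaticNumber G b → a ≡ b
chromaticNumber-unique G (col-a , least-a) (col-b , least-b) = ≤-antisym (least-a _ col-b) (least-b _ col-a)

cliqueNumber-unique : ∀ G {a b} → IsCliqueNumber G a → IsCliqueNumber G b → a ≡ b
cliqueNumber-unique G (cl-a , greatest-a) (cl-b , greatest-b) = ≤-antisym (greatest-b _ cl-a) (greatest-a _ cl-b)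

cliqueNumber≤chromaticNumber : ∀ G {ω χ} → IsCliqueNumber G ω → IsChromaticNumber G χ → ω ≤ χ
cliqueNumber≤chromaticNumber G (cl , _) (col , _) = hasClique⇒colourable⇒≤ G cl col

¬¬-chromaticNumber : ∀ G → ¬ ¬ ∃ (IsChromaticNumber G)
¬¬-chromaticNumber G = ¬¬-least (Colourable G) (colourable-order G)

¬¬-cliqueNumber : ∀ G → ¬ ¬ ∃ (IsCliqueNumber G)
¬¬-cliqueNumber G = ¬¬-greatest (HasClique G) (order G) (λ _ → hasClique⇒≤order G) (hasClique-zero G)

excess : ℕ → ℕ → ℤ
excess χ ω = + χ ℤ.- + ω

-- The bound χ + 2f − x of M(x,y) at x = 0.
vertexBound : ℕ → ℕ → ℤ
vertexBound χ ω = (+ χ ℤ.+ + 2 ℤ.* excess χ ω) ℤ.- + 0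

excess-+ : ∀ χ₁ χ₂ ω₁ ω₂ → excess (χ₁ + χ₂) (ω₁ + ω₂) ≡ excess χ₁ ω₁ ℤ.+ excess χ₂ ω₂
excess-+ χ₁ χ₂ ω₁ ω₂ = solve 4 (λ a b c d → (a :+ b) :- (c :+ d) := (a :- c) :+ (b :- d))
  refl (+ χ₁) (+ χ₂) (+ ω₁) (+ ω₂)
  where open +-*-Solver

vertexBound-+ : ∀ χ₁ χ₂ ω₁ ω₂ → vertexBound (χ₁ + χ₂) (ω₁ + ω₂) ≡ vertexBound χ₁ ω₁ ℤ.+ vertexBound χ₂ ω₂
vertexBound-+ χ₁ χ₂ ω₁ ω₂ = solve 4 (λ a b c d →
    ((a :+ b) :+ con (+ 2) :* ((a :+ b) :- (c :+ d))) :- con (+ 0)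
    := ((a :+ con (+ 2) :* (a :- c)) :- con (+ 0)) :+ ((b :+ con (+ 2) :* (b :- d)) :- con (+ 0)))
  refl (+ χ₁) (+ χ₂) (+ ω₁) (+ ω₂)
  where open +-*-Solver

excess≤excess-+ˡ : ∀ χ₁ χ₂ ω₁ ω₂ → ω₂ ≤ χ₂ → excess χ₁ ω₁ ℤ.≤ excess (χ₁ + χ₂) (ω₁ + ω₂)
excess≤excess-+ˡ χ₁ χ₂ ω₁ ω₂ ω₂≤χ₂ = subst (excess χ₁ ω₁ ℤ.≤_) (sym (excess-+ χ₁ χ₂ ω₁ ω₂))
  (ℤₚ.i≤i+j _ _ {{ℤ.nonNegative (ℤₚ.i≤j⇒0≤j-i (+≤+ ω₂≤χ₂))}})

excess≤excess-+ʳ : ∀ χ₁ χ₂ ω₁ ω₂ → ω₁ ≤ χ₁ → excess χ₂ ω₂ ℤ.≤ excess (χ₁ + χ₂) (ω₁ + ω₂)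
excess≤excess-+ʳ χ₁ χ₂ ω₁ ω₂ ω₁≤χ₁ = subst (excess χ₂ ω₂ ℤ.≤_) (sym (excess-+ χ₁ χ₂ ω₁ ω₂))
  (ℤₚ.i≤j+i _ _ {{ℤ.nonNegative (ℤₚ.i≤j⇒0≤j-i (+≤+ ω₁≤χ₁))}})

+-<-split : ∀ {i₁ i₂ j₁ j₂ : ℤ} → i₁ ℤ.+ i₂ ℤ.< j₁ ℤ.+ j₂ → i₁ ℤ.< j₁ ⊎ i₂ ℤ.< j₂
+-<-split {i₁} {_} {j₁} lt with i₁ ℤₚ.<? j₁
... | yes i₁<j₁ = inj₁ i₁<j₁
... | no  i₁≮j₁ = inj₂ (ℤₚ.≰⇒> λ j₂≤i₂ → ℤₚ.<⇒≱ lt (ℤₚ.+-mono-≤ (ℤₚ.≮⇒≥ i₁≮j₁) j₂≤i₂))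

module Join (G : Graph) (side : Fin (n G) → Bool)
            (cross : ∀ u v → side u ≡ true → side v ≡ false → adj G u v ≡ true) where

  open Partition (partition side) public

  G₁ : Graph
  G₁ = induced G (embed ∘ inj₁)

  G₂ : Graph
  G₂ = induced G (embed ∘ inj₂)

  cross-adj : ∀ i j → adj G (embed (inj₁ i)) (embed (inj₂ j)) ≡ true
  cross-adj i j = cross _ _ (p-embed₁ i) (p-embed₂ j)

  colourable-join : ∀ {a b} → Colourable G₁ a → Colourable G₂ b → Colourable G (a + b)
  colourable-join {a} {b} (c₁ , c₁-proper) (c₂ , c₂-proper) = join a b ∘ map c₁ c₂ ∘ index , proper
    where
    proper-on-parts : ∀ x y → adj G (embed x) (embed y) ≡ true → map c₁ c₂ x ≢ map c₁ c₂ y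
    proper-on-parts (inj₁ i) (inj₁ j) ij eq = c₁-proper i j ij (inj₁-injective eq)
    proper-on-parts (inj₂ i) (inj₂ j) ij eq = c₂-proper i j ij (inj₂-injective eq)
    proper-on-parts (inj₁ _) (inj₂ _) _ ()
    proper-on-parts (inj₂ _) (inj₁ _) _ ()

    proper : ProperColouring G (join a b ∘ map c₁ c₂ ∘ index)
    proper u v uv eq = proper-on-parts (index u) (index v)
      (subst₂ (λ u v → adj G u v ≡ true) (sym (embed∘index u)) (sym (embed∘index v)) uv)
      (join-injective a b eq)

  hasClique-join : ∀ {a b} → HasClique G₁ a → HasClique G₂ b → HasClique G (a + b)
  hasClique-join {a} (f₁ , f₁-injective , f₁-adj) (f₂ , f₂-injective , f₂-adj) =
    embed ∘ map f₁ f₂ ∘ splitAt a ,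
    splitAt-injective a ∘ map-injective f₁-injective f₂-injective ∘ embed-injective ,
    λ k k′ k≢k′ → adj-on-parts (splitAt a k) (splitAt a k′) (k≢k′ ∘ splitAt-injective a)
    where
    adj-on-parts : ∀ x y → x ≢ y → adj G (embed (map f₁ f₂ x)) (embed (map f₁ f₂ y)) ≡ true
    adj-on-parts (inj₁ i) (inj₁ j) i≢j = f₁-adj i j (i≢j ∘ cong inj₁)
    adj-on-parts (inj₂ i) (inj₂ j) i≢j = f₂-adj i j (i≢j ∘ cong inj₂)
    adj-on-parts (inj₁ i) (inj₂ j) _   = cross-adj (f₁ i) (f₂ j)
    adj-on-parts (inj₂ i) (inj₁ j) _   = trans (Graph.sym G _ _) (cross-adj (f₁ j) (f₂ i))

  -- Colours met on the G₁ side go to the first part; cross adjacency keeps them off the G₂ side.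
  colourable-split : ∀ {k} → Colourable G k →
    ∃₂ λ k₁ k₂ → k₁ + k₂ ≡ k × Colourable G₁ k₁ × Colourable G₂ k₂
  colourable-split (c , c-proper) =
    Q.m₁ , Q.m₂ , Q.m₁+m₂≡m ,
    colourable-factor G₁ c₁-proper (Q.embed ∘ inj₁) (proj₁ ∘ Q.embed₁-surjective ∘ used₁)
      (proj₂ ∘ Q.embed₁-surjective ∘ used₁) ,
    colourable-factor G₂ c₂-proper (Q.embed ∘ inj₂) (proj₁ ∘ Q.embed₂-surjective ∘ unused₂)
      (proj₂ ∘ Q.embed₂-surjective ∘ unused₂)
    where
    usedBy₁ : Fin _ → Bool
    usedBy₁ col = does (any? λ i → c (embed (inj₁ i)) ≟ᶠ col)

    module Q = Partition (partition usedBy₁)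

    used₁ : ∀ i → usedBy₁ (c (embed (inj₁ i))) ≡ true
    used₁ i = dec-true (any? _) (i , refl)

    unused₂ : ∀ j → usedBy₁ (c (embed (inj₂ j))) ≡ false
    unused₂ j = dec-false (any? _) λ (i , same) → c-proper _ _ (cross-adj i j) same

    c₁-proper : ProperColouring G₁ (c ∘ embed ∘ inj₁)
    c₁-proper = proj₂ (colourable-induced G (embed ∘ inj₁) (c , c-proper))

    c₂-proper : ProperColouring G₂ (c ∘ embed ∘ inj₂)
    c₂-proper = proj₂ (colourable-induced G (embed ∘ inj₂) (c , c-proper))

  hasClique-split : ∀ {k} → HasClique G k →
    ∃₂ λ k₁ k₂ → k₁ + k₂ ≡ k × HasClique G₁ k₁ × HasClique G₂ k₂
  hasClique-split (f , f-clique) =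
    Q.m₁ , Q.m₂ , Q.m₁+m₂≡m ,
    hasClique-induced G (embed ∘ inj₁) f₁-clique (proj₁ ∘ embed₁-surjective ∘ Q.p-embed₁)
      (proj₂ ∘ embed₁-surjective ∘ Q.p-embed₁) ,
    hasClique-induced G (embed ∘ inj₂) f₂-clique (proj₁ ∘ embed₂-surjective ∘ Q.p-embed₂)
      (proj₂ ∘ embed₂-surjective ∘ Q.p-embed₂)
    where
    module Q = Partition (partition (side ∘ f))

    f₁-clique : IsClique G (f ∘ Q.embed ∘ inj₁)
    f₁-clique = proj₂ (hasClique-∘ G f-clique (Q.embed ∘ inj₁) (inj₁-injective ∘ Q.embed-injective))

    f₂-clique : IsClique G (f ∘ Q.embed ∘ inj₂)
    f₂-clique = proj₂ (hasClique-∘ G f-clique (Q.embed ∘ inj₂) (inj₂-injective ∘ Q.embed-injective))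

  chromaticNumber-join : ∀ {χ₁ χ₂} → IsChromaticNumber G₁ χ₁ → IsChromaticNumber G₂ χ₂ →
    IsChromaticNumber G (χ₁ + χ₂)
  chromaticNumber-join {χ₁} {χ₂} (col₁ , least₁) (col₂ , least₂) = colourable-join col₁ col₂ , least
    where
    least : ∀ k → Colourable G k → χ₁ + χ₂ ≤ k
    least k col with k₁ , k₂ , refl , col₁′ , col₂′ ← colourable-split col =
      ℕ.+-mono-≤ (least₁ k₁ col₁′) (least₂ k₂ col₂′)

  cliqueNumber-join : ∀ {ω₁ ω₂} → IsCliqueNumber G₁ ω₁ → IsCliqueNumber G₂ ω₂ →
    IsCliqueNumber G (ω₁ + ω₂)
  cliqueNumber-join {ω₁} {ω₂} (cl₁ , greatest₁) (cl₂ , greatest₂) = hasClique-join cl₁ cl₂ , greatest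
    where
    greatest : ∀ k → HasClique G k → k ≤ ω₁ + ω₂
    greatest k cl with k₁ , k₂ , refl , cl₁′ , cl₂′ ← hasClique-split cl =
      ℕ.+-mono-≤ (greatest₁ k₁ cl₁′) (greatest₂ k₂ cl₂′)

  summand-inM : ∀ {y χ₁ ω₁ χ₂ ω₂} →
    IsChromaticNumber G₁ χ₁ → IsCliqueNumber G₁ ω₁ → IsChromaticNumber G₂ χ₂ → IsCliqueNumber G₂ ω₂ →
    InM (+ 0) y G → InM (+ 0) y G₁ ⊎ InM (+ 0) y G₂
  summand-inM {χ₁ = χ₁} {ω₁} {χ₂} {ω₂} isχ₁ isω₁ isχ₂ isω₂ (χ , ω , isχ , isω , order<bound , excess≤y)
    with refl ← chromaticNumber-unique G isχ (chromaticNumber-join isχ₁ isχ₂)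
       | refl ← cliqueNumber-unique G isω (cliqueNumber-join isω₁ isω₂) =
    map (λ lt₁ → χ₁ , ω₁ , isχ₁ , isω₁ , lt₁ , ℤₚ.≤-trans (excess≤excess-+ˡ χ₁ χ₂ ω₁ ω₂ ω₂≤χ₂) excess≤y)
        (λ lt₂ → χ₂ , ω₂ , isχ₂ , isω₂ , lt₂ , ℤₚ.≤-trans (excess≤excess-+ʳ χ₁ χ₂ ω₁ ω₂ ω₁≤χ₁) excess≤y)
        (+-<-split (subst₂ ℤ._<_ (cong +_ (sym m₁+m₂≡m)) (vertexBound-+ χ₁ χ₂ ω₁ ω₂) order<bound))
    where
    ω₁≤χ₁ : ω₁ ≤ χ₁
    ω₁≤χ₁ = cliqueNumber≤chromaticNumber G₁ isω₁ isχ₁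
    ω₂≤χ₂ : ω₂ ≤ χ₂
    ω₂≤χ₂ = cliqueNumber≤chromaticNumber G₂ isω₂ isχ₂

  ¬¬-summand-inM : ∀ {y} → InM (+ 0) y G → ¬ ¬ (InM (+ 0) y G₁ ⊎ InM (+ 0) y G₂)
  ¬¬-summand-inM G∈M = do
    χ₁ , isχ₁ ← ¬¬-chromaticNumber G₁
    ω₁ , isω₁ ← ¬¬-cliqueNumber G₁
    χ₂ , isχ₂ ← ¬¬-chromaticNumber G₂
    ω₂ , isω₂ ← ¬¬-cliqueNumber G₂
    pure (summand-inM isχ₁ isω₁ isχ₂ isω₂ G∈M)
    where open RawMonad ¬¬-Monad

lemma4p1 : (y : ℤ) → (∃[ G ] InM (+ 0) y G) →
    ∀ G₀ → IsMinimalInM (+ 0) y G₀ → Nonseparable G₀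
lemma4p1 y _ G₀ (G₀∈M , minimal) (side , (u , su) , (v , sv) , cross) =
  ¬¬-summand-inM G₀∈M λ
    { (inj₁ G₁∈M) → <⇒≱ (m₁<m sv) (minimal G₁ G₁∈M)
    ; (inj₂ G₂∈M) → <⇒≱ (m₂<m su) (minimal G₂ G₂∈M) }
  where
  open Join G₀ side cross
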